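{- Let $\varphi\in\mathsf{LTL_f}(\mathcal{P})$ with $\mathcal{P}=\mathcal{P}_o\uplus\mathcal{P}_u$, and let $\mathcal{A}^B_\varphi$ be the belief-state DFA of $\varphi$. Then for every observable word $\sigma_o\in(\mathbb{B}^{\mathcal{P}_o})^{+}$: $\sigma_o\in\mathscr{L}(\mathcal{A}^B_\varphi)$ if and only if every word $\sigma\in(\mathbb{B}^{\mathcal{P}})^{+}$ with $\sigma|_{\mathcal{P}_o}=\sigma_o$ satisfies $\sigma,0\models\varphi$.
   Context: $\mathbb{B}=\{\bot,\top\}$; assignments $w:\mathcal{P}\to\mathbb{B}$ (identified with the set of true propositions); $w_1\sqcup w_2$ combines assignments over disjoint sets; $\sigma|_{\mathcal{P}_o}$ restricts each letter to $\mathcal{P}_o$. A finite word of length $n$ is a map $\{0,\dots,n-1\}\to\mathbb{B}^{\mathcal{P}}$. $\mathsf{LTL_f}(\mathcal{P})$ formulas: $\varphi::=\mathit{tt}\mid\mathit{ff}\mid p\mid\neg\varphi\mid\varphi\odot\varphi\mid \mathsf{X}\varphi\mid\mathsf{X}^{s}\varphi\mid\mathsf{F}\varphi\mid\mathsf{G}\varphi\mid\varphi\,\mathsf{U}\,\varphi\mid\varphi\,\mathsf{R}\,\varphi$. Semantics for $\sigma$ of length $n$, $0\le i<n$: $\sigma,i\models\mathit{tt}$ iff $i<n$; $\sigma,i\models\mathit{ff}$ iff $i=n$; $\sigma,i\models p$ iff $p\in\sigma(i)$; Boolean connectives as usual; $\mathsf{X}\varphi$: $i+1=n$ or $\sigma,i+1\models\varphi$;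 $\mathsf{X}^s\varphi$: $i+1<n$ and $\sigma,i+1\models\varphi$; $\mathsf{F}\varphi$: $\exists j\in[i,n)$, $\sigma,j\models\varphi$; $\mathsf{G}\varphi$: $\forall j\in[i,n)$, $\sigma,j\models\varphi$; $\varphi_1\mathsf{U}\varphi_2$: $\exists j\in[i,n)$ with $\sigma,j\models\varphi_2$ and $\forall k\in[i,j)$, $\sigma,k\models\varphi_1$; $\varphi_1\mathsf{R}\varphi_2$: $\forall j\in[i,n)$, $\sigma,j\models\varphi_2$ or $\exists k\in[i,j)$, $\sigma,k\models\varphi_1$. Propositional equivalence $\sim$: replace each maximal temporal subformula $\psi$ by a fresh Boolean variable $x_\psi$, and compare the resulting Boolean formulas semantically. $[\varphi]_\sim$ is a fixed unique representative of the $\sim$-class. Pairs: $(\varphi_1,b_1)\odot(\varphi_2,b_2)=([\varphi_1\odot\varphi_2]_\sim,b_1\odot b_2)$, $\neg(\varphi,b)=([\neg\varphi]_\sim,\neg b)$, $\bigwedge X=(\bigwedge_{(\varphi,b)\in X}\varphi,\bigwedge_{(\varphi,b)\in X}b)$. Formula progression $\mathrm{fp}(\varphi,w)\in\mathsf{LTL_f}(\mathcal{P})\times\mathbb{B}$: $\mathrm{fp}(\mathit{tt},w)=(\mathit{tt},\top)$, $\mathrm{fp}(\mathit{ff},w)=(\mathit{ff},\bot)$; $\mathrm{fp}(p,w)=(\mathit{tt},\top)$ if $p\in w$, else $(\mathit{ff},\bot)$; $\mathrm{fp}(\neg\varphi,w)=\neg\mathrm{fp}(\varphi,w)$; $\mathrm{fp}(\varphi_1\odot\varphi_2,w)=\mathrm{fp}(\varphi_1,w)\odot\mathrm{fp}(\varphi_2,w)$;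 $\mathrm{fp}(\mathsf{X}\varphi,w)=(\varphi,\top)$; $\mathrm{fp}(\mathsf{X}^s\varphi,w)=(\varphi,\bot)$; $\mathrm{fp}(\mathsf{F}\varphi,w)=\mathrm{fp}(\varphi,w)\vee(\mathsf{F}\varphi,\bot)$; $\mathrm{fp}(\mathsf{G}\varphi,w)=\mathrm{fp}(\varphi,w)\wedge(\mathsf{G}\varphi,\top)$; $\mathrm{fp}(\varphi_1\mathsf{U}\varphi_2,w)=\mathrm{fp}(\varphi_2,w)\vee(\mathrm{fp}(\varphi_1,w)\wedge(\varphi_1\mathsf{U}\varphi_2,\bot))$; $\mathrm{fp}(\varphi_1\mathsf{R}\varphi_2,w)=\mathrm{fp}(\varphi_2,w)\wedge(\mathrm{fp}(\varphi_1,w)\vee(\varphi_1\mathsf{R}\varphi_2,\top))$. Observable progression: $\mathrm{fp}_{\mathrm{obs}}(\psi,w_o)=\bigwedge\{\mathrm{fp}(\psi,w)\mid w\in\mathbb{B}^{\mathcal{P}},\ w|_{\mathcal{P}_o}=w_o\}$, extended to words by $\mathrm{fp}_{\mathrm{obs}}(\varphi,\sigma_o\cdot w_o)=\mathrm{fp}_{\mathrm{obs}}(\psi,w_o)$ where $\psi$ is the first component of $\mathrm{fp}_{\mathrm{obs}}(\varphi,\sigma_o)$. Belief-state DFA $\mathcal{A}^B_\varphi=\langle\mathcal{S},\mathbb{B}^{\mathcal{P}_o},\iota^B,\delta^B,\mathcal{T}^B\rangle$: $\mathcal{S}=\{[\varphi]_\sim\}\cup\{[\psi']_\sim\mid(\psi',\_)=\mathrm{fp}_{\mathrm{obs}}(\varphi,\sigma_o),\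 \sigma_o\in(\mathbb{B}^{\mathcal{P}_o})^+\}$; $\iota^B=[\varphi]_\sim$; $\delta^B(s,w_o)=s'$ where $(s',\_)=\mathrm{fp}_{\mathrm{obs}}(s,w_o)$; accepting transitions $\mathcal{T}^B=\{(s,w_o)\mid(\_,\top)=\mathrm{fp}_{\mathrm{obs}}(s,w_o)\}$. A word $w_o^0\cdots w_o^{n-1}$ ($n\ge1$) with run $s_0=\iota^B$, $s_{t+1}=\delta^B(s_t,w_o^t)$ is accepted (in $\mathscr{L}(\mathcal{A}^B_\varphi)$) iff its last transition $(s_{n-1},w_o^{n-1})\in\mathcal{T}^B$. -}

module Defs where

open import Data.Bool using (Bool; true; false; _∧_; _∨_; not)
open import Data.Nat using (ℕ; zero; suc; _<_; _≤_)
open import Data.Fin using (Fin; fromℕ<)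
open import Data.Sum using (_⊎_; inj₁; inj₂)
open import Data.Product using (_×_; _,_; Σ; proj₁; proj₂)
open import Data.List using (List; []; _∷_; length; lookup; map; foldr; concatMap)
open import Data.List.NonEmpty using (List⁺; _∷_; toList)
open import Relation.Binary.PropositionalEquality using (_≡_)

data Formula (A : Set) : Set where
  tt ff      : Formula A
  atom       : A → Formula A
  ¬f_        : Formula A → Formula A
  _∧f_ _∨f_  : Formula A → Formula A → Formula A
  Xf Xsf Ff Gf : Formula A → Formula A
  _Uf_ _Rf_  : Formula A → Formula A → Formula A

Assign : Set → Set
Assign A = A → Bool

-- Propositional evaluation: atoms and maximal temporal subformulas are
-- treated as propositional variables, valued by v.
peval : {A : Set} → (Formula A → Bool) → Formula A → Bool
peval v tt = true
peval v ff = false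
peval v (atom p) = v (atom p)
peval v (¬f φ) = not (peval v φ)
peval v (φ ∧f ψ) = peval v φ ∧ peval v ψ
peval v (φ ∨f ψ) = peval v φ ∨ peval v ψ
peval v (Xf φ) = v (Xf φ)
peval v (Xsf φ) = v (Xsf φ)
peval v (Ff φ) = v (Ff φ)
peval v (Gf φ) = v (Gf φ)
peval v (φ Uf ψ) = v (φ Uf ψ)
peval v (φ Rf ψ) = v (φ Rf ψ)

_∼_ : {A : Set} → Formula A → Formula A → Set
φ ∼ ψ = ∀ v → peval v φ ≡ peval v ψ

record IsRepresentative {A : Set} (norm : Formula A → Formula A) : Set where
  field
    norm-∼      : ∀ φ → norm φ ∼ φ
    norm-unique : ∀ φ ψ → φ ∼ ψ → norm φ ≡ norm ψ

module _ {A : Set} (σ : List (Assign A)) where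
  private
    n = length σ

  _⊨_ : ℕ → Formula A → Set
  i ⊨ tt = i < n
  i ⊨ ff = i ≡ n
  i ⊨ atom p = Σ (i < n) λ h → lookup σ (fromℕ< h) p ≡ true
  i ⊨ (¬f φ) = i ⊨ φ → Data.Empty.⊥
    where import Data.Empty
  i ⊨ (φ ∧f ψ) = (i ⊨ φ) × (i ⊨ ψ)
  i ⊨ (φ ∨f ψ) = (i ⊨ φ) ⊎ (i ⊨ ψ)
  i ⊨ Xf φ = (suc i ≡ n) ⊎ (suc i ⊨ φ)
  i ⊨ Xsf φ = (suc i < n) × (suc i ⊨ φ)
  i ⊨ Ff φ = Σ ℕ λ j → (i ≤ j) × (j < n) × (j ⊨ φ)
  i ⊨ Gf φ = ∀ j → i ≤ j → j < n → j ⊨ φ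
  i ⊨ (φ Uf ψ) = Σ ℕ λ j → (i ≤ j) × (j < n) × (j ⊨ ψ)
                   × (∀ k → i ≤ k → k < j → k ⊨ φ)
  i ⊨ (φ Rf ψ) = ∀ j → i ≤ j → j < n →
                   (j ⊨ ψ) ⊎ Σ ℕ λ k → (i ≤ k) × (k < j) × (k ⊨ φ)

allAssign : (m : ℕ) → List (Assign (Fin m))
allAssign zero = (λ ()) ∷ []
allAssign (suc m) = concatMap (λ w → (λ { Fin.zero → false ; (Fin.suc k) → w k })
                                   ∷ (λ { Fin.zero → true ; (Fin.suc k) → w k }) ∷ [])
                              (allAssign m)
  where import Data.Fin as Fin

_⊔_ : {Po Pu : Set} → Assign Po → Assign Pu → Assign (Po ⊎ Pu)
(wo ⊔ wu) (inj₁ p) = wo p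
(wo ⊔ wu) (inj₂ p) = wu p

module Progression (no nu : ℕ)
  (norm : Formula (Fin no ⊎ Fin nu) → Formula (Fin no ⊎ Fin nu)) where

  P = Fin no ⊎ Fin nu
  Pair = Formula P × Bool

  _∧p_ : Pair → Pair → Pair
  (φ₁ , b₁) ∧p (φ₂ , b₂) = norm (φ₁ ∧f φ₂) , (b₁ ∧ b₂)

  _∨p_ : Pair → Pair → Pair
  (φ₁ , b₁) ∨p (φ₂ , b₂) = norm (φ₁ ∨f φ₂) , (b₁ ∨ b₂)

  ¬p : Pair → Pair
  ¬p (φ , b) = norm (¬f φ) , not b

  fp : Formula P → Assign P → Pair
  fp tt w = tt , true
  fp ff w = ff , false
  fp (atom p) w with w p
  ... | true = tt , true
  ... | false = ff , false
  fp (¬f φ) w = ¬p (fp φ w)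
  fp (φ ∧f ψ) w = fp φ w ∧p fp ψ w
  fp (φ ∨f ψ) w = fp φ w ∨p fp ψ w
  fp (Xf φ) w = φ , true
  fp (Xsf φ) w = φ , false
  fp (Ff φ) w = fp φ w ∨p (Ff φ , false)
  fp (Gf φ) w = fp φ w ∧p (Gf φ , true)
  fp (φ Uf ψ) w = fp ψ w ∨p (fp φ w ∧p ((φ Uf ψ) , false))
  fp (φ Rf ψ) w = fp ψ w ∧p (fp φ w ∨p ((φ Rf ψ) , true))

  ⋀ : List Pair → Pair
  ⋀ = foldr _∧p_ (tt , true)

  fpObs : Formula P → Assign (Fin no) → Pair
  fpObs ψ wo = ⋀ (map (λ wu → fp ψ (wo ⊔ wu)) (allAssign nu))

  ιB : Formula P → Formula P
  ιB φ = norm φ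

  δB : Formula P → Assign (Fin no) → Formula P
  δB s wo = proj₁ (fpObs s wo)

  acceptingTr : Formula P → Assign (Fin no) → Bool
  acceptingTr s wo = proj₂ (fpObs s wo)

  -- Acceptance from state s: the last transition is accepting
  acceptsFrom′ : Formula P → Assign (Fin no) → List (Assign (Fin no)) → Bool
  acceptsFrom′ s wo [] = acceptingTr s wo
  acceptsFrom′ s wo (wo' ∷ ws) = acceptsFrom′ (δB s wo) wo' ws

  acceptsFrom : Formula P → List⁺ (Assign (Fin no)) → Bool
  acceptsFrom s (wo ∷ ws) = acceptsFrom′ s wo ws

  InLanguage : Formula P → List⁺ (Assign (Fin no)) → Set
  InLanguage φ σo = acceptsFrom (ιB φ) σo ≡ true

data Restricts {no nu : ℕ} : List (Assign (Fin no ⊎ Fin nu)) → List (Assign (Fin no)) → Set where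
  []  : Restricts [] []
  _∷_ : ∀ {w wo σ σo} → (∀ p → w (inj₁ p) ≡ wo p) → Restricts σ σo → Restricts (w ∷ σ) (wo ∷ σo)

{-# OPTIONS --safe #-}
module Submission where

-- Reading a progression pair (ψ , b) on a word ws as "ψ holds on ws, or ws is
-- empty and b", formula progression is exactly the one-step expansion of the
-- LTLf semantics, so σ , 0 ⊨ φ is decided by progressing φ through σ and
-- reading off the Boolean of the last step.  This Boolean evaluation commutes
-- with the connectives on pairs, hence it is invariant under the propositional
-- equivalence used to normalise states.  Observable progression conjoins the
-- progressions over all completions of an observable letter, so running the
-- belief-state DFA on σₒ computes the conjunction of these evaluations over
-- all completions σ of σₒ.

open import Defs
open import Data.Bool using (Bool; true; false; T; not; _∧_; _∨_)
open import Data.Bool.Properties using (T-≡; T-∧)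
open import Data.Empty using (⊥-elim)
open import Data.Fin using (Fin; zero; suc)
open import Data.List using (List; []; _∷_; [_]; length; map)
open import Data.List.NonEmpty using (List⁺; _∷_; toList)
open import Data.List.Relation.Unary.All as All using (All; []; _∷_)
open import Data.List.Relation.Unary.All.Properties using (map⁺; map⁻)
open import Data.List.Relation.Unary.Any as Any using (Any; here; there)
open import Data.List.Relation.Unary.Any.Properties using (concatMap⁺)
open import Data.Nat using (ℕ; zero; suc; _≤_; _<_; z≤n; s≤s; s≤s⁻¹)
open import Data.Nat.Properties using (suc-injective; ≤⇒≯)
open import Data.Product using (_×_; _,_; Σ)
open import Data.Product.Function.NonDependent.Propositional using (_×-⇔_)
open import Data.Sum using (_⊎_; inj₁; inj₂)
open import Data.Sum.Function.Propositional using (_⊎-⇔_)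
open import Function using (_∘_; const)
open import Function.Bundles using (_⇔_; mk⇔; Equivalence)
open import Function.Construct.Symmetry using (⇔-sym)
open import Function.Related.TypeIsomorphisms using (¬-cong-⇔)
open import Relation.Nullary using (Dec; yes; no; _because_)
open import Relation.Nullary.Reflects
  using (Reflects; ofʸ; ofⁿ; ¬-reflects; _×-reflects_; _⊎-reflects_; T-reflects)
open import Relation.Binary.PropositionalEquality
  using (_≡_; refl; sym; trans; cong; cong₂; subst; _≗_; module ≡-Reasoning)

open Equivalence using (to; from)

reflects-⇔ : {A B : Set} {b : Bool} → A ⇔ B → Reflects A b → Reflects B b
reflects-⇔ A⇔B (ofʸ a)  = ofʸ (to A⇔B a)
reflects-⇔ A⇔B (ofⁿ ¬a) = ofⁿ (¬a ∘ from A⇔B)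

reflects⇒⇔T : {A : Set} {b : Bool} → Reflects A b → A ⇔ T b
reflects⇒⇔T (ofʸ a)  = mk⇔ (const _) (const a)
reflects⇒⇔T (ofⁿ ¬a) = mk⇔ ¬a (λ ())

∃-bounded-suc⇔ : {P Q : ℕ → Set} {i n : ℕ} → (∀ j → P (suc j) ⇔ Q j) →
  (Σ ℕ λ j → suc i ≤ j × j < suc n × P j) ⇔ (Σ ℕ λ j → i ≤ j × j < n × Q j)
∃-bounded-suc⇔ P⇔Q = mk⇔
  (λ { (suc j , s≤s i≤j , s≤s j<n , p) → j , i≤j , j<n , to (P⇔Q j) p })
  (λ (j , i≤j , j<n , q) → suc j , s≤s i≤j , s≤s j<n , from (P⇔Q j) q)

∀-bounded-suc⇔ : {P Q : ℕ → Set} {i n : ℕ} → (∀ j → P (suc j) ⇔ Q j) →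
  (∀ j → suc i ≤ j → j < suc n → P j) ⇔ (∀ j → i ≤ j → j < n → Q j)
∀-bounded-suc⇔ P⇔Q = mk⇔
  (λ p j i≤j j<n → to (P⇔Q j) (p (suc j) (s≤s i≤j) (s≤s j<n)))
  (λ { q (suc j) (s≤s i≤j) (s≤s j<n) → from (P⇔Q j) (q j i≤j j<n) })

allAssign-complete : ∀ m (w : Assign (Fin m)) → Any (w ≗_) (allAssign m)
allAssign-complete zero    w = here (λ ())
allAssign-complete (suc m) w with w zero in w₀
... | false = concatMap⁺ _ (Any.map (λ w≗v → here (λ { zero → w₀ ; (suc k) → w≗v k }))
                                   (allAssign-complete m (w ∘ suc)))
... | true  = concatMap⁺ _ (Any.map (λ w≗v → there (here (λ { zero → w₀ ; (suc k) → w≗v k })))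
                                   (allAssign-complete m (w ∘ suc)))

≗-⊔ : {Po Pu : Set} {w : Assign (Po ⊎ Pu)} {wo : Assign Po} {wu : Assign Pu} →
  w ∘ inj₁ ≗ wo → w ∘ inj₂ ≗ wu → w ≗ wo ⊔ wu
≗-⊔ w≗wo w≗wu (inj₁ p) = w≗wo p
≗-⊔ w≗wo w≗wu (inj₂ p) = w≗wu p

module _ {A : Set} where

  _⊨[_]_ : List (Assign A) → ℕ → Formula A → Set
  σ ⊨[ i ] φ = _⊨_ σ i φ

  ⊨-suc⇔ : ∀ (w : Assign A) σ i φ → (w ∷ σ) ⊨[ suc i ] φ ⇔ σ ⊨[ i ] φ
  ⊨-suc⇔ w σ i tt       = mk⇔ s≤s⁻¹ s≤s
  ⊨-suc⇔ w σ i ff       = mk⇔ suc-injective (cong suc)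
  ⊨-suc⇔ w σ i (atom p) = mk⇔ (λ (h , e) → s≤s⁻¹ h , e) (λ (h , e) → s≤s h , e)
  ⊨-suc⇔ w σ i (¬f φ)   = ¬-cong-⇔ (⊨-suc⇔ w σ i φ)
  ⊨-suc⇔ w σ i (φ ∧f ψ) = ⊨-suc⇔ w σ i φ ×-⇔ ⊨-suc⇔ w σ i ψ
  ⊨-suc⇔ w σ i (φ ∨f ψ) = ⊨-suc⇔ w σ i φ ⊎-⇔ ⊨-suc⇔ w σ i ψ
  ⊨-suc⇔ w σ i (Xf φ)   = mk⇔ suc-injective (cong suc) ⊎-⇔ ⊨-suc⇔ w σ (suc i) φ
  ⊨-suc⇔ w σ i (Xsf φ)  = mk⇔ s≤s⁻¹ s≤s ×-⇔ ⊨-suc⇔ w σ (suc i) φ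
  ⊨-suc⇔ w σ i (Ff φ)   = ∃-bounded-suc⇔ (λ j → ⊨-suc⇔ w σ j φ)
  ⊨-suc⇔ w σ i (Gf φ)   = ∀-bounded-suc⇔ (λ j → ⊨-suc⇔ w σ j φ)
  ⊨-suc⇔ w σ i (φ Uf ψ) =
    ∃-bounded-suc⇔ (λ j → ⊨-suc⇔ w σ j ψ ×-⇔ ∀-bounded-suc⇔ (λ k → ⊨-suc⇔ w σ k φ))
  ⊨-suc⇔ w σ i (φ Rf ψ) =
    ∀-bounded-suc⇔ (λ j → ⊨-suc⇔ w σ j ψ ⊎-⇔ ∃-bounded-suc⇔ (λ k → ⊨-suc⇔ w σ k φ))

  module _ (w x : Assign A) (xs : List (Assign A)) where

    Xf-unfold : ∀ φ → (w ∷ x ∷ xs) ⊨[ 0 ] Xf φ ⇔ (x ∷ xs) ⊨[ 0 ] φ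
    Xf-unfold φ = mk⇔ (λ { (inj₁ ()) ; (inj₂ p) → to (⊨-suc⇔ w (x ∷ xs) 0 φ) p })
                      (inj₂ ∘ from (⊨-suc⇔ w (x ∷ xs) 0 φ))

    Xsf-unfold : ∀ φ → (w ∷ x ∷ xs) ⊨[ 0 ] Xsf φ ⇔ (x ∷ xs) ⊨[ 0 ] φ
    Xsf-unfold φ = mk⇔ (λ (_ , p) → to (⊨-suc⇔ w (x ∷ xs) 0 φ) p)
                       (λ p → s≤s (s≤s z≤n) , from (⊨-suc⇔ w (x ∷ xs) 0 φ) p)

  module _ (w : Assign A) (ws : List (Assign A)) where

    Ff-unfold : ∀ φ → (w ∷ ws) ⊨[ 0 ] Ff φ ⇔ ((w ∷ ws) ⊨[ 0 ] φ ⊎ (w ∷ ws) ⊨[ 1 ] Ff φ)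
    Ff-unfold φ = mk⇔
      (λ { (zero  , _ , _   , p) → inj₁ p
         ; (suc j , _ , j<n , p) → inj₂ (suc j , s≤s z≤n , j<n , p) })
      (λ { (inj₁ p)               → 0 , z≤n , s≤s z≤n , p
         ; (inj₂ (j , _ , j<n , p)) → j , z≤n , j<n , p })

    Gf-unfold : ∀ φ → (w ∷ ws) ⊨[ 0 ] Gf φ ⇔ ((w ∷ ws) ⊨[ 0 ] φ × (w ∷ ws) ⊨[ 1 ] Gf φ)
    Gf-unfold φ = mk⇔
      (λ p → p 0 z≤n (s≤s z≤n) , λ j _ j<n → p j z≤n j<n)
      (λ { (p₀ , p) zero _ _ → p₀ ; (p₀ , p) (suc j) _ j<n → p (suc j) (s≤s z≤n) j<n })

    Uf-unfold : ∀ φ ψ → (w ∷ ws) ⊨[ 0 ] (φ Uf ψ) ⇔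
      ((w ∷ ws) ⊨[ 0 ] ψ ⊎ ((w ∷ ws) ⊨[ 0 ] φ × (w ∷ ws) ⊨[ 1 ] (φ Uf ψ)))
    Uf-unfold φ ψ = mk⇔
      (λ { (zero , _ , _ , q , _) → inj₁ q
         ; (suc j , _ , j<n , q , p) →
             inj₂ (p 0 z≤n (s≤s z≤n) , suc j , s≤s z≤n , j<n , q , λ k _ k<j → p k z≤n k<j) })
      (λ { (inj₁ q) → 0 , z≤n , s≤s z≤n , q , λ _ _ ()
         ; (inj₂ (p₀ , j , _ , j<n , q , p)) → j , z≤n , j<n , q ,
             λ { zero _ _ → p₀ ; (suc k) _ k<j → p (suc k) (s≤s z≤n) k<j } })

    -- Constructively, splitting a release into "φ now" or "release from 1 on"
    -- needs φ to be decidable at 0.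
    Rf-unfold : ∀ φ ψ → Dec ((w ∷ ws) ⊨[ 0 ] φ) → (w ∷ ws) ⊨[ 0 ] (φ Rf ψ) ⇔
      ((w ∷ ws) ⊨[ 0 ] ψ × ((w ∷ ws) ⊨[ 0 ] φ ⊎ (w ∷ ws) ⊨[ 1 ] (φ Rf ψ)))
    Rf-unfold φ ψ φ₀? = mk⇔ (λ r → ψ₀ r , now-or-later φ₀? r) release
      where
      ψ₀ : (w ∷ ws) ⊨[ 0 ] (φ Rf ψ) → (w ∷ ws) ⊨[ 0 ] ψ
      ψ₀ r with r 0 z≤n (s≤s z≤n)
      ... | inj₁ q = q
      now-or-later : Dec ((w ∷ ws) ⊨[ 0 ] φ) → (w ∷ ws) ⊨[ 0 ] (φ Rf ψ) →
                     (w ∷ ws) ⊨[ 0 ] φ ⊎ (w ∷ ws) ⊨[ 1 ] (φ Rf ψ)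
      now-or-later (yes p₀) r = inj₁ p₀
      now-or-later (no ¬p₀) r = inj₂ λ j _ j<n → skip-0 (r j z≤n j<n)
        where
        skip-0 : ∀ {j} →
          (w ∷ ws) ⊨[ j ] ψ ⊎ Σ ℕ (λ k → 0 ≤ k × k < j × (w ∷ ws) ⊨[ k ] φ) →
          (w ∷ ws) ⊨[ j ] ψ ⊎ Σ ℕ (λ k → 1 ≤ k × k < j × (w ∷ ws) ⊨[ k ] φ)
        skip-0 (inj₁ q)                     = inj₁ q
        skip-0 (inj₂ (zero , _ , _ , p₀))   = ⊥-elim (¬p₀ p₀)
        skip-0 (inj₂ (suc k , _ , k<j , p)) = inj₂ (suc k , s≤s z≤n , k<j , p)
      release : (w ∷ ws) ⊨[ 0 ] ψ × ((w ∷ ws) ⊨[ 0 ] φ ⊎ (w ∷ ws) ⊨[ 1 ] (φ Rf ψ)) →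
                (w ∷ ws) ⊨[ 0 ] (φ Rf ψ)
      release (q₀ , _)      zero    _ _   = inj₁ q₀
      release (_ , inj₁ p₀) (suc j) _ _   = inj₂ (0 , z≤n , s≤s z≤n , p₀)
      release (_ , inj₂ r) (suc j) _ j<n with r (suc j) (s≤s z≤n) j<n
      ... | inj₁ q = inj₁ q
      ... | inj₂ (k , _ , k<j , p) = inj₂ (k , z≤n , k<j , p)

  -- The Booleans that fp attaches to the temporal operators.
  module _ (σ : List (Assign A)) where

    Ff-at-end : ∀ φ → Reflects (σ ⊨[ length σ ] Ff φ) false
    Ff-at-end φ = ofⁿ λ (j , n≤j , j<n , _) → ≤⇒≯ n≤j j<n

    Gf-at-end : ∀ φ → Reflects (σ ⊨[ length σ ] Gf φ) true
    Gf-at-end φ = ofʸ λ j n≤j j<n → ⊥-elim (≤⇒≯ n≤j j<n)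

    Uf-at-end : ∀ φ ψ → Reflects (σ ⊨[ length σ ] (φ Uf ψ)) false
    Uf-at-end φ ψ = ofⁿ λ (j , n≤j , j<n , _) → ≤⇒≯ n≤j j<n

    Rf-at-end : ∀ φ ψ → Reflects (σ ⊨[ length σ ] (φ Rf ψ)) true
    Rf-at-end φ ψ = ofʸ λ j n≤j j<n → ⊥-elim (≤⇒≯ n≤j j<n)

module _ (no nu : ℕ) (norm : Formula (Fin no ⊎ Fin nu) → Formula (Fin no ⊎ Fin nu)) where
  open Progression no nu norm

  holds : List (Assign P) → Pair → Bool
  holds []       (_ , b) = b
  holds (w ∷ ws) (ψ , _) = holds ws (fp ψ w)

  holds-tt : ∀ ws → holds ws (tt , true) ≡ true
  holds-tt []       = refl
  holds-tt (_ ∷ ws) = holds-tt ws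

  holds-ff : ∀ ws → holds ws (ff , false) ≡ false
  holds-ff []       = refl
  holds-ff (_ ∷ ws) = holds-ff ws

  holds-fp-atom : ∀ ws w p → holds ws (fp (atom p) w) ≡ w p
  holds-fp-atom ws w p with w p
  ... | true  = holds-tt ws
  ... | false = holds-ff ws

  fp-cong : ∀ {w w′} → w ≗ w′ → ∀ φ → fp φ w ≡ fp φ w′
  fp-cong w≗w′ tt       = refl
  fp-cong w≗w′ ff       = refl
  fp-cong w≗w′ (atom p) rewrite w≗w′ p = refl
  fp-cong w≗w′ (¬f φ)   = cong ¬p (fp-cong w≗w′ φ)
  fp-cong w≗w′ (φ ∧f ψ) = cong₂ _∧p_ (fp-cong w≗w′ φ) (fp-cong w≗w′ ψ)
  fp-cong w≗w′ (φ ∨f ψ) = cong₂ _∨p_ (fp-cong w≗w′ φ) (fp-cong w≗w′ ψ)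
  fp-cong w≗w′ (Xf φ)   = refl
  fp-cong w≗w′ (Xsf φ)  = refl
  fp-cong w≗w′ (Ff φ)   = cong (_∨p _) (fp-cong w≗w′ φ)
  fp-cong w≗w′ (Gf φ)   = cong (_∧p _) (fp-cong w≗w′ φ)
  fp-cong w≗w′ (φ Uf ψ) = cong₂ _∨p_ (fp-cong w≗w′ ψ) (cong (_∧p _) (fp-cong w≗w′ φ))
  fp-cong w≗w′ (φ Rf ψ) = cong₂ _∧p_ (fp-cong w≗w′ ψ) (cong (_∨p _) (fp-cong w≗w′ φ))

  module _ (isRep : IsRepresentative norm) where
    open IsRepresentative isRep

    mutual
      holds-∧p : ∀ ws p q → holds ws (p ∧p q) ≡ holds ws p ∧ holds ws q
      holds-∧p []       _       _       = refl
      holds-∧p (w ∷ ws) (φ , _) (ψ , _) =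
        trans (holds-fp-norm ws w (φ ∧f ψ)) (holds-∧p ws (fp φ w) (fp ψ w))

      holds-∨p : ∀ ws p q → holds ws (p ∨p q) ≡ holds ws p ∨ holds ws q
      holds-∨p []       _       _       = refl
      holds-∨p (w ∷ ws) (φ , _) (ψ , _) =
        trans (holds-fp-norm ws w (φ ∨f ψ)) (holds-∨p ws (fp φ w) (fp ψ w))

      holds-¬p : ∀ ws p → holds ws (¬p p) ≡ not (holds ws p)
      holds-¬p []       _       = refl
      holds-¬p (w ∷ ws) (φ , _) = trans (holds-fp-norm ws w (¬f φ)) (holds-¬p ws (fp φ w))

      holds-fp-norm : ∀ ws w φ → holds ws (fp (norm φ) w) ≡ holds ws (fp φ w)
      holds-fp-norm ws w φ = begin
        holds ws (fp (norm φ) w)  ≡⟨ holds-fp-peval ws w (norm φ) ⟩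
        peval v (norm φ)          ≡⟨ norm-∼ φ v ⟩
        peval v φ                 ≡⟨ holds-fp-peval ws w φ ⟨
        holds ws (fp φ w)         ∎
        where
        open ≡-Reasoning
        v : Formula P → Bool
        v ψ = holds ws (fp ψ w)

      holds-fp-peval : ∀ ws w φ → holds ws (fp φ w) ≡ peval (λ ψ → holds ws (fp ψ w)) φ
      holds-fp-peval ws w tt       = holds-tt ws
      holds-fp-peval ws w ff       = holds-ff ws
      holds-fp-peval ws w (atom p) = refl
      holds-fp-peval ws w (¬f φ)   =
        trans (holds-¬p ws (fp φ w)) (cong not (holds-fp-peval ws w φ))
      holds-fp-peval ws w (φ ∧f ψ) =
        trans (holds-∧p ws (fp φ w) (fp ψ w))
              (cong₂ _∧_ (holds-fp-peval ws w φ) (holds-fp-peval ws w ψ))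
      holds-fp-peval ws w (φ ∨f ψ) =
        trans (holds-∨p ws (fp φ w) (fp ψ w))
              (cong₂ _∨_ (holds-fp-peval ws w φ) (holds-fp-peval ws w ψ))
      holds-fp-peval ws w (Xf φ)   = refl
      holds-fp-peval ws w (Xsf φ)  = refl
      holds-fp-peval ws w (Ff φ)   = refl
      holds-fp-peval ws w (Gf φ)   = refl
      holds-fp-peval ws w (φ Uf ψ) = refl
      holds-fp-peval ws w (φ Rf ψ) = refl

    holds-⋀ : ∀ ws ps → T (holds ws (⋀ ps)) ⇔ All (T ∘ holds ws) ps
    holds-⋀ ws [] rewrite holds-tt ws = mk⇔ (const []) (const _)
    holds-⋀ ws (p ∷ ps) rewrite holds-∧p ws p (⋀ ps) = mk⇔
      (λ t → let (tp , tps) = to T-∧ t in tp ∷ to (holds-⋀ ws ps) tps)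
      (λ { (tp ∷ tps) → from T-∧ (tp , from (holds-⋀ ws ps) tps) })

    holds-fpObs : ∀ ws s wo →
      T (holds ws (fpObs s wo)) ⇔ (∀ w → w ∘ inj₁ ≗ wo → T (holds ws (fp s w)))
    holds-fpObs ws s wo = mk⇔ every-completion all-completions
      where
      progressions : List Pair
      progressions = map (λ wu → fp s (wo ⊔ wu)) (allAssign nu)
      every-completion : T (holds ws (fpObs s wo)) → ∀ w → w ∘ inj₁ ≗ wo → T (holds ws (fp s w))
      every-completion t w w≗wo =
        let (t′ , w≗wu) = All.lookupAny (map⁻ (to (holds-⋀ ws progressions) t))
                                        (allAssign-complete nu (w ∘ inj₂))
        in subst (T ∘ holds ws) (sym (fp-cong (≗-⊔ w≗wo w≗wu) s)) t′
      all-completions : (∀ w → w ∘ inj₁ ≗ wo → T (holds ws (fp s w))) → T (holds ws (fpObs s wo))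
      all-completions h =
        from (holds-⋀ ws progressions) (map⁺ (All.tabulate λ {wu} _ → h (wo ⊔ wu) λ _ → refl))

    acceptsFrom′⇔ : ∀ s wo wos → T (acceptsFrom′ s wo wos) ⇔
      (∀ w σ → w ∘ inj₁ ≗ wo → Restricts σ wos → T (holds σ (fp s w)))
    acceptsFrom′⇔ s wo [] = mk⇔
      (λ { t w [] w≗wo [] → to (holds-fpObs [] s wo) t w w≗wo })
      (λ h → from (holds-fpObs [] s wo) λ w w≗wo → h w [] w≗wo [])
    acceptsFrom′⇔ s wo (wo′ ∷ wos) = mk⇔
      (λ { t w (w′ ∷ σ) w≗wo (w′≗wo′ ∷ σ↾) →
             to (holds-fpObs (w′ ∷ σ) s wo)
                (to (acceptsFrom′⇔ (δB s wo) wo′ wos) t w′ σ w′≗wo′ σ↾) w w≗wo })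
      (λ h → from (acceptsFrom′⇔ (δB s wo) wo′ wos) λ w′ σ w′≗wo′ σ↾ →
             from (holds-fpObs (w′ ∷ σ) s wo) λ w w≗wo → h w (w′ ∷ σ) w≗wo (w′≗wo′ ∷ σ↾))

    mutual
      ⊨-reflects : ∀ w ws φ → Reflects ((w ∷ ws) ⊨[ 0 ] φ) (holds ws (fp φ w))
      ⊨-reflects w ws tt rewrite holds-tt ws = ofʸ (s≤s z≤n)
      ⊨-reflects w ws ff rewrite holds-ff ws = ofⁿ λ ()
      ⊨-reflects w ws (atom p) rewrite holds-fp-atom ws w p =
        reflects-⇔ (mk⇔ (λ t → s≤s z≤n , to T-≡ t) (λ (_ , e) → from T-≡ e)) (T-reflects (w p))
      ⊨-reflects w ws (¬f φ) rewrite holds-¬p ws (fp φ w) = ¬-reflects (⊨-reflects w ws φ)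
      ⊨-reflects w ws (φ ∧f ψ) rewrite holds-∧p ws (fp φ w) (fp ψ w) =
        ⊨-reflects w ws φ ×-reflects ⊨-reflects w ws ψ
      ⊨-reflects w ws (φ ∨f ψ) rewrite holds-∨p ws (fp φ w) (fp ψ w) =
        ⊨-reflects w ws φ ⊎-reflects ⊨-reflects w ws ψ
      ⊨-reflects w []       (Xf φ)  = ofʸ (inj₁ refl)
      ⊨-reflects w (x ∷ xs) (Xf φ)  = reflects-⇔ (⇔-sym (Xf-unfold w x xs φ)) (⊨-reflects x xs φ)
      ⊨-reflects w []       (Xsf φ) = ofⁿ λ { (s≤s () , _) }
      ⊨-reflects w (x ∷ xs) (Xsf φ) = reflects-⇔ (⇔-sym (Xsf-unfold w x xs φ)) (⊨-reflects x xs φ)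
      ⊨-reflects w ws (Ff φ) rewrite holds-∨p ws (fp φ w) (Ff φ , false) =
        reflects-⇔ (⇔-sym (Ff-unfold w ws φ))
          (⊨-reflects w ws φ ⊎-reflects ⊨-suc-reflects w ws (Ff φ) false (Ff-at-end [ w ] φ))
      ⊨-reflects w ws (Gf φ) rewrite holds-∧p ws (fp φ w) (Gf φ , true) =
        reflects-⇔ (⇔-sym (Gf-unfold w ws φ))
          (⊨-reflects w ws φ ×-reflects ⊨-suc-reflects w ws (Gf φ) true (Gf-at-end [ w ] φ))
      ⊨-reflects w ws (φ Uf ψ)
        rewrite holds-∨p ws (fp ψ w) (fp φ w ∧p (φ Uf ψ , false))
              | holds-∧p ws (fp φ w) (φ Uf ψ , false) =
        reflects-⇔ (⇔-sym (Uf-unfold w ws φ ψ))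
          (⊨-reflects w ws ψ ⊎-reflects
            (⊨-reflects w ws φ ×-reflects ⊨-suc-reflects w ws (φ Uf ψ) false (Uf-at-end [ w ] φ ψ)))
      ⊨-reflects w ws (φ Rf ψ)
        rewrite holds-∧p ws (fp ψ w) (fp φ w ∨p (φ Rf ψ , true))
              | holds-∨p ws (fp φ w) (φ Rf ψ , true) =
        reflects-⇔ (⇔-sym (Rf-unfold w ws φ ψ (_ because ⊨-reflects w ws φ)))
          (⊨-reflects w ws ψ ×-reflects
            (⊨-reflects w ws φ ⊎-reflects ⊨-suc-reflects w ws (φ Rf ψ) true (Rf-at-end [ w ] φ ψ)))

      ⊨-suc-reflects : ∀ w ws ψ b → Reflects ([ w ] ⊨[ 1 ] ψ) b →
        Reflects ((w ∷ ws) ⊨[ 1 ] ψ) (holds ws (ψ , b))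
      ⊨-suc-reflects w []       ψ b at-end = at-end
      ⊨-suc-reflects w (x ∷ xs) ψ b _      =
        reflects-⇔ (⇔-sym (⊨-suc⇔ w (x ∷ xs) 0 ψ)) (⊨-reflects x xs ψ)

    inLanguage⇔ : ∀ φ σo → InLanguage φ σo ⇔ (∀ σ → Restricts σ (toList σo) → σ ⊨[ 0 ] φ)
    inLanguage⇔ φ (wo ∷ wos) = mk⇔
      (λ { acc (w ∷ σ) (w≗wo ∷ σ↾) →
             from (sat⇔ w σ) (to (acceptsFrom′⇔ (norm φ) wo wos) (from T-≡ acc) w σ w≗wo σ↾) })
      (λ sat → to T-≡ (from (acceptsFrom′⇔ (norm φ) wo wos) λ w σ w≗wo σ↾ →
             to (sat⇔ w σ) (sat (w ∷ σ) (w≗wo ∷ σ↾))))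
      where
      sat⇔ : ∀ w σ → (w ∷ σ) ⊨[ 0 ] φ ⇔ T (holds σ (fp (norm φ) w))
      sat⇔ w σ rewrite holds-fp-norm σ w φ = reflects⇒⇔T (⊨-reflects w σ φ)

theorem1 : (no nu : ℕ) (norm : Formula (Fin no ⊎ Fin nu) → Formula (Fin no ⊎ Fin nu))
    → IsRepresentative norm
    → (φ : Formula (Fin no ⊎ Fin nu)) (σo : List⁺ (Assign (Fin no)))
    → (Progression.InLanguage no nu norm φ σo
        → ((σ : List (Assign (Fin no ⊎ Fin nu))) → Restricts σ (toList σo) → _⊨_ σ 0 φ))
      × (((σ : List (Assign (Fin no ⊎ Fin nu))) → Restricts σ (toList σo) → _⊨_ σ 0 φ)
        → Progression.InLanguage no nu norm φ σo)
theorem1 _ _ norm isRep φ σo =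
  to (inLanguage⇔ _ _ norm isRep φ σo) , from (inLanguage⇔ _ _ norm isRep φ σo)
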